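{- Let $\mathcal D$ be a family of upwards closed dependencies and let $\phi$ be a formula of $\mathrm{FO}(\mathcal D)$. Let $M$ be a first-order model and $X$, $Y$ teams over $M$ such that $X\subseteq Y$, $M\models_X\phi$ and $M\models_Y\phi^f$. Then $M\models_Y\phi$.
   Context: Team semantics: models have domain $\mathrm{dom}(M)$ with at least two elements. A team $X$ over $M$ with domain a finite set of variables $V$ is a set of assignments $s:V\to\mathrm{dom}(M)$; for a tuple $\bar x$ of variables in $V$, $X(\bar x)=\{s(\bar x): s\in X\}$. Formulas are in negation normal form, and $M\models_X\phi$ is defined by: for a first-order literal $\alpha$, $M\models_X\alpha$ iff every $s\in X$ satisfies $\alpha$ in the Tarskian sense; $M\models_X\psi\vee\theta$ iff $X=Y\cup Z$ for some $Y,Z$ with $M\models_Y\psi$ and $M\models_Z\theta$; $M\models_X\psi\wedge\theta$ iff both hold on $X$; $M\models_X\exists v\psi$ iff there is $H:X\to\mathcal P(\mathrm{dom}(M))\setminus\{\emptyset\}$ with $M\models_{X[H/v]}\psi$, where $X[H/v]=\{s[m/v]: s\in X, m\in H(s)\}$; $M\models_X\forall v\psi$ iff $M\models_{X[M/v]}\psi$, where $X[M/v]=\{s[m/v]: s\in X, m\in\mathrm{dom}(M)\}$. A dependency of arity $n$ is a class $\mathbf D$ of structures $(\mathrm{dom}(M),R)$, $R$ an $n$-ary relation, closed under isomorphism; the atom $\mathbf D\bar x$ is satisfied by $X$ in $M$ iff $(\mathrm{dom}(M),X(\bar x))\in\mathbf D$. $\mathrm{FO}(\mathcal D)$ is first-order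 logic extended with all atoms $\mathbf D\bar x$, $\mathbf D\in\mathcal D$. $\mathbf D$ is upwards closed if $(\mathrm{dom}(M),R)\in\mathbf D$ and $R\subseteq S$ imply $(\mathrm{dom}(M),S)\in\mathbf D$. The flattening $\phi^f$ is the first-order formula obtained from $\phi$ by replacing every dependency atom by the trivially true atom $\top$. -}

module Defs where

open import Level using (Level; 0ℓ) renaming (suc to lsuc)
open import Data.Nat using (ℕ; _≟_)
open import Data.Fin using (Fin)
open import Data.Product using (Σ; ∃; _×_; _,_)
open import Data.Sum using (_⊎_)
open import Data.Empty using (⊥)
open import Data.Unit using (⊤)
open import Relation.Nullary using (¬_; yes; no)
open import Relation.Binary.PropositionalEquality using (_≡_; _≢_)
open import Function.Bundles using (_↔_; Inverse; _⇔_)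

record Signature : Set₁ where
  field
    FunSym   : Set
    funArity : FunSym → ℕ
    RelSym   : Set
    relArity : RelSym → ℕ
open Signature public

record Model (σ : Signature) : Set₁ where
  field
    Dom    : Set
    funI   : (f : FunSym σ) → (Fin (funArity σ f) → Dom) → Dom
    relI   : (R : RelSym σ) → (Fin (relArity σ R) → Dom) → Set
    twoElements : Σ Dom λ a → Σ Dom λ b → a ≢ b
open Model public

Var : Set
Var = ℕ

data Term (σ : Signature) : Set where
  var : Var → Term σ
  app : (f : FunSym σ) → (Fin (funArity σ f) → Term σ) → Term σ

Assignment : Set → Set
Assignment D = Var → D

Team : Set → Set₁
Team D = Assignment D → Set

_⊆T_ : {D : Set} → Team D → Team D → Set
X ⊆T Y = ∀ s → X s → Y s

eval : {σ : Signature} (M : Model σ) → Assignment (Dom M) → Term σ → Dom M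
eval M s (var v)    = s v
eval M s (app f ts) = funI M f (λ k → eval M s (ts k))

update : {D : Set} → Assignment D → Var → D → Assignment D
update s v m w with w ≟ v
... | yes _ = m
... | no  _ = s w

NRel : ℕ → Set → Set₁
NRel n D = (Fin n → D) → Set

record Dependency (n : ℕ) : Set₁ where
  field
    holds : (D : Set) → NRel n D → Set
    isoClosed : {D D' : Set} (f : D ↔ D') (R : NRel n D) (S : NRel n D') →
                (∀ t → R t ⇔ S (λ k → Inverse.to f (t k))) →
                holds D R → holds D' S
open Dependency public

UpwardsClosed : {n : ℕ} → Dependency n → Set₁
UpwardsClosed {n} 𝐃 = (D : Set) (R S : NRel n D) →
  holds 𝐃 D R → (∀ t → R t → S t) → holds 𝐃 D S

record DepFamily : Set₁ where
  field
    Name  : Set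
    arity : Name → ℕ
    dep   : (i : Name) → Dependency (arity i)
open DepFamily public

-- Formulas of FO(𝒟) in negation normal form

data Formula (σ : Signature) (𝒟 : DepFamily) : Set where
  top    : Formula σ 𝒟
  rel    : (R : RelSym σ) → (Fin (relArity σ R) → Term σ) → Formula σ 𝒟
  nrel   : (R : RelSym σ) → (Fin (relArity σ R) → Term σ) → Formula σ 𝒟
  eq     : Term σ → Term σ → Formula σ 𝒟
  neq    : Term σ → Term σ → Formula σ 𝒟
  depAt  : (i : Name 𝒟) → (Fin (arity 𝒟 i) → Var) → Formula σ 𝒟
  _∨'_   : Formula σ 𝒟 → Formula σ 𝒟 → Formula σ 𝒟
  _∧'_   : Formula σ 𝒟 → Formula σ 𝒟 → Formula σ 𝒟
  ex     : Var → Formula σ 𝒟 → Formula σ 𝒟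
  all    : Var → Formula σ 𝒟 → Formula σ 𝒟

flatten : {σ : Signature} {𝒟 : DepFamily} → Formula σ 𝒟 → Formula σ 𝒟
flatten top         = top
flatten (rel R ts)  = rel R ts
flatten (nrel R ts) = nrel R ts
flatten (eq t u)    = eq t u
flatten (neq t u)   = neq t u
flatten (depAt i x) = top
flatten (φ ∨' ψ)    = flatten φ ∨' flatten ψ
flatten (φ ∧' ψ)    = flatten φ ∧' flatten ψ
flatten (ex v φ)    = ex v (flatten φ)
flatten (all v φ)   = all v (flatten φ)

teamRel : {D : Set} {n : ℕ} → Team D → (Fin n → Var) → NRel n D
teamRel X x t = ∃ λ s → X s × (∀ k → s (x k) ≡ t k)

supplement : {D : Set} → Team D → (Assignment D → D → Set) → Var → Team D
supplement X H v s' =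
  ∃ λ s → ∃ λ m → X s × H s m × (∀ w → s' w ≡ update s v m w)

duplicate : {D : Set} → Team D → Var → Team D
duplicate X v s' = ∃ λ s → ∃ λ m → X s × (∀ w → s' w ≡ update s v m w)

sat : {σ : Signature} {𝒟 : DepFamily} (M : Model σ) →
      Team (Dom M) → Formula σ 𝒟 → Set₁
sat M X top         = Level.Lift _ ⊤
sat M X (rel R ts)  = Level.Lift _ (∀ s → X s → relI M R (λ k → eval M s (ts k)))
sat M X (nrel R ts) = Level.Lift _ (∀ s → X s → ¬ relI M R (λ k → eval M s (ts k)))
sat M X (eq t u)    = Level.Lift _ (∀ s → X s → eval M s t ≡ eval M s u)
sat M X (neq t u)   = Level.Lift _ (∀ s → X s → eval M s t ≢ eval M s u)
sat {𝒟 = 𝒟} M X (depAt i x) = Level.Lift _ (holds (dep 𝒟 i) (Dom M) (teamRel X x))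
sat M X (φ ∨' ψ)    = Σ (Team (Dom M)) λ Y → Σ (Team (Dom M)) λ Z →
  (∀ s → X s ⇔ (Y s ⊎ Z s)) × sat M Y φ × sat M Z ψ
sat M X (φ ∧' ψ)    = sat M X φ × sat M X ψ
sat M X (ex v φ)    = Σ (Assignment (Dom M) → Dom M → Set) λ H →
  (∀ s → X s → ∃ λ m → H s m) × sat M (supplement X H v) φ
sat M X (all v φ)   = sat M (duplicate X v) φ

-- A first-order formula is union closed, and every team satisfying φ also satisfies φᶠ.  At a dependency atom X(x̄) ⊆ Y(x̄), so upwards closure applies.  At a
-- disjunction, split X = X₁ ∪ X₂ for φ and Y = Y₁ ∪ Y₂ for φᶠ, and use X₁ ∪ Y₁, X₂ ∪ Y₂
-- as the split of Y: each part contains the corresponding Xᵢ and, by union closure,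
-- satisfies the flattened disjunct.  At ∃v, extend the witness function for Y by that for
-- X on the assignments of X, so that X[H/v] ⊆ Y[H'/v] and again union closure applies.
module Submission where

open import Defs
open import Level using (lift)
open import Data.Product using (∃; _×_; _,_)
open import Data.Sum using (_⊎_; inj₁; inj₂; [_,_]′)
open import Data.Unit using (tt)
open import Function.Bundles using (_⇔_; mk⇔; Equivalence)
open import Function.Construct.Identity using (⇔-id)

open Equivalence

module _ {D : Set} where

  _∪T_ : Team D → Team D → Team D
  (X ∪T Y) s = X s ⊎ Y s

  _≐_ : Team D → Team D → Set
  X ≐ Y = ∀ s → X s ⇔ Y s

  infix 5 _∪T_
  infix 4 _≐_

  ≐-refl : {X : Team D} → X ≐ X
  ≐-refl s = ⇔-id _

  ≐∪⇒⊆ˡ : {X Y Z : Team D} → Z ≐ X ∪T Y → X ⊆T Z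
  ≐∪⇒⊆ˡ e s x = from (e s) (inj₁ x)

  ⊆⇒≐∪ : {X Y : Team D} → X ⊆T Y → Y ≐ X ∪T Y
  ⊆⇒≐∪ sub s = mk⇔ inj₂ [ sub s , (λ y → y) ]′

  ∀-≐∪ : {Y₁ Y₂ Z : Team D} {P : Assignment D → Set} → Z ≐ Y₁ ∪T Y₂ →
         (∀ s → Y₁ s → P s) → (∀ s → Y₂ s → P s) → ∀ s → Z s → P s
  ∀-≐∪ e p q s z = [ p s , q s ]′ (to (e s) z)

  ≐∪-medial : {Z Y₁ Y₂ A₁ B₁ A₂ B₂ : Team D} →
              Z ≐ Y₁ ∪T Y₂ → Y₁ ≐ A₁ ∪T B₁ → Y₂ ≐ A₂ ∪T B₂ →
              Z ≐ (A₁ ∪T A₂) ∪T (B₁ ∪T B₂)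
  ≐∪-medial {Z} {Y₁} {Y₂} {A₁} {B₁} {A₂} {B₂} e e₁ e₂ s = mk⇔ split join
    where
    split : Z s → (A₁ s ⊎ A₂ s) ⊎ (B₁ s ⊎ B₂ s)
    split z with to (e s) z
    ... | inj₁ y = [ (λ a → inj₁ (inj₁ a)) , (λ b → inj₂ (inj₁ b)) ]′ (to (e₁ s) y)
    ... | inj₂ y = [ (λ a → inj₁ (inj₂ a)) , (λ b → inj₂ (inj₂ b)) ]′ (to (e₂ s) y)
    join : (A₁ s ⊎ A₂ s) ⊎ (B₁ s ⊎ B₂ s) → Z s
    join (inj₁ (inj₁ a)) = ≐∪⇒⊆ˡ e s (from (e₁ s) (inj₁ a))
    join (inj₁ (inj₂ a)) = from (e s) (inj₂ (from (e₂ s) (inj₁ a)))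
    join (inj₂ (inj₁ b)) = ≐∪⇒⊆ˡ e s (from (e₁ s) (inj₂ b))
    join (inj₂ (inj₂ b)) = from (e s) (inj₂ (from (e₂ s) (inj₂ b)))

  duplicate-≐∪ : {Y₁ Y₂ Z : Team D} (v : Var) → Z ≐ Y₁ ∪T Y₂ →
                 duplicate Z v ≐ duplicate Y₁ v ∪T duplicate Y₂ v
  duplicate-≐∪ {Y₁} {Y₂} {Z} v e s′ = mk⇔ split join
    where
    split : duplicate Z v s′ → duplicate Y₁ v s′ ⊎ duplicate Y₂ v s′
    split (s , m , z , q) =
      [ (λ y → inj₁ (s , m , y , q)) , (λ y → inj₂ (s , m , y , q)) ]′ (to (e s) z)
    join : duplicate Y₁ v s′ ⊎ duplicate Y₂ v s′ → duplicate Z v s′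
    join (inj₁ (s , m , y , q)) = s , m , from (e s) (inj₁ y) , q
    join (inj₂ (s , m , y , q)) = s , m , from (e s) (inj₂ y) , q

  joinChoice : Team D → (Assignment D → D → Set) → Team D → (Assignment D → D → Set) →
               Assignment D → D → Set
  joinChoice Y₁ H₁ Y₂ H₂ s m = (Y₁ s × H₁ s m) ⊎ (Y₂ s × H₂ s m)

  joinChoice-nonempty : {Y₁ Y₂ Z : Team D} {H₁ H₂ : Assignment D → D → Set} →
                        Z ≐ Y₁ ∪T Y₂ →
                        (∀ s → Y₁ s → ∃ (H₁ s)) → (∀ s → Y₂ s → ∃ (H₂ s)) →
                        ∀ s → Z s → ∃ (joinChoice Y₁ H₁ Y₂ H₂ s)
  joinChoice-nonempty e n₁ n₂ = ∀-≐∪ e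
    (λ s y → let (m , h) = n₁ s y in m , inj₁ (y , h))
    (λ s y → let (m , h) = n₂ s y in m , inj₂ (y , h))

  supplement-≐∪ : {Y₁ Y₂ Z : Team D} {H₁ H₂ : Assignment D → D → Set} (v : Var) →
                  Z ≐ Y₁ ∪T Y₂ →
                  supplement Z (joinChoice Y₁ H₁ Y₂ H₂) v
                    ≐ supplement Y₁ H₁ v ∪T supplement Y₂ H₂ v
  supplement-≐∪ {Y₁} {Y₂} {Z} {H₁} {H₂} v e s′ = mk⇔ split join
    where
    split : supplement Z (joinChoice Y₁ H₁ Y₂ H₂) v s′ →
            supplement Y₁ H₁ v s′ ⊎ supplement Y₂ H₂ v s′
    split (s , m , _ , inj₁ (y , h) , q) = inj₁ (s , m , y , h , q)
    split (s , m , _ , inj₂ (y , h) , q) = inj₂ (s , m , y , h , q)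
    join : supplement Y₁ H₁ v s′ ⊎ supplement Y₂ H₂ v s′ →
           supplement Z (joinChoice Y₁ H₁ Y₂ H₂) v s′
    join (inj₁ (s , m , y , h , q)) = s , m , from (e s) (inj₁ y) , inj₁ (y , h) , q
    join (inj₂ (s , m , y , h , q)) = s , m , from (e s) (inj₂ y) , inj₂ (y , h) , q

module _ {σ : Signature} {𝒟 : DepFamily} (M : Model σ) where

  sat-flatten : (φ : Formula σ 𝒟) {X : Team (Dom M)} → sat M X φ → sat M X (flatten φ)
  sat-flatten top         p = p
  sat-flatten (rel R ts)  p = p
  sat-flatten (nrel R ts) p = p
  sat-flatten (eq t u)    p = p
  sat-flatten (neq t u)   p = p
  sat-flatten (depAt i x) p = lift tt
  sat-flatten (φ ∨' ψ) (Y , Z , e , p , q) = Y , Z , e , sat-flatten φ p , sat-flatten ψ q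
  sat-flatten (φ ∧' ψ) (p , q) = sat-flatten φ p , sat-flatten ψ q
  sat-flatten (ex v φ) (H , n , p) = H , n , sat-flatten φ p
  sat-flatten (all v φ) p = sat-flatten φ p

  flatten-unionClosed : (φ : Formula σ 𝒟) {Y₁ Y₂ Z : Team (Dom M)} → Z ≐ Y₁ ∪T Y₂ →
                        sat M Y₁ (flatten φ) → sat M Y₂ (flatten φ) → sat M Z (flatten φ)
  flatten-unionClosed top         e _ _ = lift tt
  flatten-unionClosed (depAt i x) e _ _ = lift tt
  flatten-unionClosed (rel R ts)  e (lift p) (lift q) = lift (∀-≐∪ e p q)
  flatten-unionClosed (nrel R ts) e (lift p) (lift q) = lift (∀-≐∪ e p q)
  flatten-unionClosed (eq t u)    e (lift p) (lift q) = lift (∀-≐∪ e p q)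
  flatten-unionClosed (neq t u)   e (lift p) (lift q) = lift (∀-≐∪ e p q)
  flatten-unionClosed (φ ∨' ψ) e (A₁ , B₁ , e₁ , p₁ , q₁) (A₂ , B₂ , e₂ , p₂ , q₂) =
    A₁ ∪T A₂ , B₁ ∪T B₂ , ≐∪-medial e e₁ e₂ ,
    flatten-unionClosed φ ≐-refl p₁ p₂ , flatten-unionClosed ψ ≐-refl q₁ q₂
  flatten-unionClosed (φ ∧' ψ) e (p₁ , q₁) (p₂ , q₂) =
    flatten-unionClosed φ e p₁ p₂ , flatten-unionClosed ψ e q₁ q₂
  flatten-unionClosed (ex v φ) e (H₁ , n₁ , p₁) (H₂ , n₂ , p₂) =
    joinChoice _ H₁ _ H₂ , joinChoice-nonempty e n₁ n₂ ,
    flatten-unionClosed φ (supplement-≐∪ v e) p₁ p₂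
  flatten-unionClosed (all v φ) e p₁ p₂ = flatten-unionClosed φ (duplicate-≐∪ v e) p₁ p₂

  sat-superteam : (∀ i → UpwardsClosed (dep 𝒟 i)) →
                  (φ : Formula σ 𝒟) {X Y : Team (Dom M)} →
                  X ⊆T Y → sat M X φ → sat M Y (flatten φ) → sat M Y φ
  sat-superteam uc top         sub _ q = q
  sat-superteam uc (rel R ts)  sub _ q = q
  sat-superteam uc (nrel R ts) sub _ q = q
  sat-superteam uc (eq t u)    sub _ q = q
  sat-superteam uc (neq t u)   sub _ q = q
  sat-superteam uc (depAt i x) sub (lift p) _ =
    lift (uc i (Dom M) _ _ p λ { t (s , xs , e) → s , sub s xs , e })
  sat-superteam uc (φ ∨' ψ) sub (X₁ , X₂ , eX , p₁ , p₂) (Y₁ , Y₂ , eY , q₁ , q₂) =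
    X₁ ∪T Y₁ , X₂ ∪T Y₂ , ≐∪-medial (⊆⇒≐∪ sub) eX eY ,
    sat-superteam uc φ (λ _ → inj₁) p₁
      (flatten-unionClosed φ ≐-refl (sat-flatten φ p₁) q₁) ,
    sat-superteam uc ψ (λ _ → inj₁) p₂
      (flatten-unionClosed ψ ≐-refl (sat-flatten ψ p₂) q₂)
  sat-superteam uc (φ ∧' ψ) sub (p₁ , p₂) (q₁ , q₂) =
    sat-superteam uc φ sub p₁ q₁ , sat-superteam uc ψ sub p₂ q₂
  sat-superteam uc (ex v φ) {X} {Y} sub (HX , nX , p) (HY , nY , q) =
    joinChoice _ HX _ HY , joinChoice-nonempty (⊆⇒≐∪ sub) nX nY ,
    sat-superteam uc φ (≐∪⇒⊆ˡ e) p (flatten-unionClosed φ e (sat-flatten φ p) q)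
    where
    e : supplement Y (joinChoice X HX Y HY) v ≐ supplement X HX v ∪T supplement Y HY v
    e = supplement-≐∪ v (⊆⇒≐∪ sub)
  sat-superteam uc (all v φ) sub p q =
    sat-superteam uc φ (≐∪⇒⊆ˡ (duplicate-≐∪ v (⊆⇒≐∪ sub))) p q

theorem3p9 : {σ : Signature} (𝒟 : DepFamily) →
    (∀ i → UpwardsClosed (dep 𝒟 i)) →
    (φ : Formula σ 𝒟) (M : Model σ) (X Y : Team (Dom M)) →
    X ⊆T Y → sat M X φ → sat M Y (flatten φ) → sat M Y φ
theorem3p9 𝒟 uc φ M X Y = sat-superteam M uc φ
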